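{- Let $F_1,F_2,F_3$ be finite integral domains (i.e. finite fields) with $|F_i^*|=n_i$ for $i=1,2,3$ and $n_1\geq n_2\geq n_3$, and let $R=F_1\times F_2\times F_3$. Then $$\alpha(\Gamma(R))=n_1n_2+n_1n_3+\max\{n_1,\,n_2n_3\}.$$
   Context: $F^*=F\setminus\{0\}$. For a commutative ring $R$ with $1\neq 0$, $\Gamma(R)$ is the simple undirected graph whose vertices are the nonzero zero-divisors of $R$, two distinct vertices $x,y$ being adjacent iff $xy=0$. $\alpha(G)$ is the independence number of a graph $G$ (maximum size of a set of pairwise non-adjacent vertices). -}

module Defs where

open import Level using (Level; _⊔_)
open import Data.Nat using (ℕ)
open import Data.Fin using (Fin)
open import Data.Product using (Σ; ∃; _×_; _,_)
open import Data.Sum using (_⊎_)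
open import Data.List using (List; length)
open import Data.List.Relation.Unary.All using (All)
open import Data.List.Relation.Unary.AllPairs using (AllPairs)
open import Relation.Nullary using (¬_)
open import Relation.Binary.PropositionalEquality as ≡ using (_≡_)
open import Function.Bundles using (Inverse)
open import Algebra.Bundles using (CommutativeRing)
import Algebra.Construct.DirectProduct as DP

private variable c ℓ : Level

module _ (R : CommutativeRing c ℓ) where
  open CommutativeRing R

  IsVertex : Carrier → Set (c ⊔ ℓ)
  IsVertex x = (¬ x ≈ 0#) × ∃ λ y → (¬ y ≈ 0#) × (x * y ≈ 0#)

  Adjacent : Carrier → Carrier → Set ℓ
  Adjacent x y = x * y ≈ 0#

  record IndependentSet : Set (c ⊔ ℓ) where
    field
      elems      : List Carrier
      distinct   : AllPairs (λ x y → ¬ x ≈ y) elems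
      vertices   : All IsVertex elems
      nonAdjacent : AllPairs (λ x y → ¬ Adjacent x y) elems

  IndependenceNumber : ℕ → Set (c ⊔ ℓ)
  IndependenceNumber N =
    (Σ IndependentSet λ I → length (IndependentSet.elems I) ≡ N) ×
    (∀ (I : IndependentSet) → length (IndependentSet.elems I) Data.Nat.≤ N)

  Finite : Set (c ⊔ ℓ)
  Finite = ∃ λ m → Inverse (≡.setoid (Fin m)) setoid

  record IsFiniteIntegralDomain : Set (c ⊔ ℓ) where
    field
      finite       : Finite
      nontrivial   : ¬ 1# ≈ 0#
      noZeroDivisors : ∀ x y → x * y ≈ 0# → x ≈ 0# ⊎ y ≈ 0#

  record NonzeroCount (n : ℕ) : Set (c ⊔ ℓ) where
    field
      enum      : Fin n → Carrier
      injective : ∀ i j → enum i ≈ enum j → i ≡ j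
      nonzero   : ∀ i → ¬ enum i ≈ 0#
      covers    : ∀ x → ¬ x ≈ 0# → ∃ λ i → x ≈ enum i

triple : CommutativeRing c ℓ → CommutativeRing c ℓ → CommutativeRing c ℓ →
         CommutativeRing c ℓ
triple F₁ F₂ F₃ = DP.commutativeRing F₁ (DP.commutativeRing F₂ F₃)

-- Identify each coordinate of F₁ × F₂ × F₃ with an element of Maybe (Fin nᵢ), nothing
-- standing for 0. An element is then a nonzero zero-divisor exactly when its support is a
-- nonempty proper subset of {1,2,3}, and two elements have nonzero product exactly when their
-- supports meet. An independent set is therefore a family of elements with pairwise
-- intersecting supports. If the family contains an element supported on {k} alone, every
-- member has k in its support; otherwise all supports have size two, and any two such subsets
-- of {1,2,3} meet. So the largest families are the star at 1 (n₁n₂ + n₁n₃ + n₁ elements,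
-- the other stars being no larger when n₁ ≥ n₂ ≥ n₃) and the family of all two-point supports
-- (n₁n₂ + n₁n₃ + n₂n₃ elements).
module Submission where

open import Defs
open import Level using (Level)
open import Algebra.Bundles using (CommutativeRing)
open import Data.Fin using (Fin)
import Data.Fin.Properties as Fin
open import Data.List using (List; []; _∷_; length; map; _++_; cartesianProduct; allFin)
open import Data.List.Properties using (length-map; length-++; length-tabulate; length-removeAt′)
open import Data.List.Relation.Unary.All as All using (All; []; _∷_)
import Data.List.Relation.Unary.All.Properties as Allₚ
open import Data.List.Relation.Unary.AllPairs as AllPairs using (AllPairs; []; _∷_)
import Data.List.Relation.Unary.AllPairs.Properties as AllPairsₚ
open import Data.List.Relation.Unary.Any using (Any; here; there; index; _─_)
open import Data.List.Relation.Unary.Unique.Propositional using (Unique)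
import Data.List.Relation.Unary.Unique.Propositional.Properties as Uniqueₚ
open import Data.List.Relation.Binary.Disjoint.Propositional using (Disjoint)
open import Data.List.Relation.Binary.Subset.Propositional using (_⊆_)
open import Data.List.Membership.Propositional using (_∈_; find)
open import Data.List.Membership.Propositional.Properties
  using (∈-map⁺; ∈-map⁻; ∈-++⁺ˡ; ∈-++⁺ʳ; ∈-++⁻; ∈-cartesianProduct⁺; ∈-allFin)
open import Data.Maybe using (Maybe; just; nothing)
open import Data.Nat using (ℕ; suc; _+_; _*_; _≤_; _≥_; _⊔_; z≤n; s≤s)
open import Data.Nat.Properties
  using (≤-refl; ≤-trans; ≤-reflexive; ≤-total; +-assoc; +-mono-≤; *-mono-≤; m≤m⊔n; m≤n⊔m;
         m≥n⇒m⊔n≡m; m≤n⇒m⊔n≡n; module ≤-Reasoning)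
open import Data.Product using (Σ; _×_; _,_; proj₁; proj₂)
open import Data.Sum using (_⊎_; inj₁; inj₂; [_,_]′)
open import Function using (_∘_; id)
open import Function.Properties.Inverse using (Inverse⇒Injection)
import Function.Construct.Symmetry as Symmetry
open import Relation.Binary.Core using (Rel)
open import Relation.Binary.Definitions using (Symmetric; Decidable)
open import Relation.Binary.PropositionalEquality as ≡ using (_≡_; _≢_; refl; cong; cong₂)
open import Relation.Nullary using (¬_; yes; no; contradiction)
open import Relation.Nullary.Decidable using (via-injection)

module _ {a} {A : Set a} where

  ∈-─⁺ : ∀ {x y} {xs : List A} (x∈xs : x ∈ xs) → y ∈ xs → y ≢ x → y ∈ (xs ─ x∈xs)
  ∈-─⁺ (here refl)  (here refl)  y≢x = contradiction refl y≢x
  ∈-─⁺ (here _)     (there y∈xs) _   = y∈xs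
  ∈-─⁺ (there _)    (here y≡z)   _   = here y≡z
  ∈-─⁺ (there x∈xs) (there y∈xs) y≢x = there (∈-─⁺ x∈xs y∈xs y≢x)

  Unique-⊆⇒length-≤ : ∀ {xs ys : List A} → Unique xs → xs ⊆ ys → length xs ≤ length ys
  Unique-⊆⇒length-≤ {[]}     _              _     = z≤n
  Unique-⊆⇒length-≤ {x ∷ xs} {ys} (x∉xs ∷ xs!) xs⊆ys = begin
    suc (length xs)          ≤⟨ s≤s (Unique-⊆⇒length-≤ xs! xs⊆ys─x) ⟩
    suc (length (ys ─ x∈ys)) ≡⟨ ≡.sym (length-removeAt′ ys (index x∈ys)) ⟩
    length ys                ∎
    where
    open ≤-Reasoning
    x∈ys : x ∈ ys
    x∈ys = xs⊆ys (here refl)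
    xs⊆ys─x : xs ⊆ (ys ─ x∈ys)
    xs⊆ys─x y∈xs = ∈-─⁺ x∈ys (xs⊆ys (there y∈xs)) (All.lookup x∉xs y∈xs ∘ ≡.sym)

  AllPairs⇒∈-related : ∀ {r} {R : Rel A r} → Symmetric R →
                       ∀ {xs x y} → AllPairs R xs → x ∈ xs → y ∈ xs → x ≡ y ⊎ R x y
  AllPairs⇒∈-related sym-R (_   ∷ _)   (here refl) (here refl) = inj₁ refl
  AllPairs⇒∈-related sym-R (Rx ∷ _)   (here refl) (there y∈) = inj₂ (All.lookup Rx y∈)
  AllPairs⇒∈-related sym-R (Rx ∷ _)   (there x∈) (here refl) = inj₂ (sym-R (All.lookup Rx x∈))
  AllPairs⇒∈-related sym-R (_  ∷ Rxs) (there x∈) (there y∈)  = AllPairs⇒∈-related sym-R Rxs x∈ y∈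

  All⇒AllPairs : ∀ {p r} {P : A → Set p} {R : Rel A r} →
                 (∀ {x y} → P x → P y → R x y) → ∀ {xs} → All P xs → AllPairs R xs
  All⇒AllPairs P⇒R []         = []
  All⇒AllPairs P⇒R (px ∷ pxs) = All.map (P⇒R px) pxs ∷ All⇒AllPairs P⇒R pxs

  All-⊎⇒Any⊎All : ∀ {p q} {P : A → Set p} {Q : A → Set q} {xs} →
                  All (λ x → P x ⊎ Q x) xs → Any P xs ⊎ All Q xs
  All-⊎⇒Any⊎All []              = inj₂ []
  All-⊎⇒Any⊎All (inj₁ px ∷ _)   = inj₁ (here px)
  All-⊎⇒Any⊎All (inj₂ qx ∷ pqs) with All-⊎⇒Any⊎All pqs
  ... | inj₁ any-P = inj₁ (there any-P)
  ... | inj₂ all-Q = inj₂ (qx ∷ all-Q)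

length-cartesianProduct : ∀ {a b} {A : Set a} {B : Set b} (xs : List A) (ys : List B) →
                          length (cartesianProduct xs ys) ≡ length xs * length ys
length-cartesianProduct []       ys = refl
length-cartesianProduct (x ∷ xs) ys =
  ≡.trans (length-++ (map (x ,_) ys))
          (cong₂ _+_ (length-map (x ,_) ys) (length-cartesianProduct xs ys))

allFin² : ∀ m k → List (Fin m × Fin k)
allFin² m k = cartesianProduct (allFin m) (allFin k)

∈-allFin² : ∀ {m k} (i : Fin m) (j : Fin k) → (i , j) ∈ allFin² m k
∈-allFin² i j = ∈-cartesianProduct⁺ (∈-allFin i) (∈-allFin j)

length-allFin : ∀ m → length (allFin m) ≡ m
length-allFin m = length-tabulate id

length-allFin² : ∀ m k → length (allFin² m k) ≡ m * k
length-allFin² m k = ≡.trans (length-cartesianProduct (allFin m) (allFin k))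
                             (cong₂ _*_ (length-allFin m) (length-allFin k))

Unique-allFin² : ∀ m k → Unique (allFin² m k)
Unique-allFin² m k = Uniqueₚ.cartesianProduct⁺ (Uniqueₚ.allFin⁺ m) (Uniqueₚ.allFin⁺ k)

+-mono³-≤ : ∀ {a b c a′ b′ c′} → a ≤ a′ → b ≤ b′ → c ≤ c′ → a + (b + c) ≤ a′ + (b′ + c′)
+-mono³-≤ a≤a′ b≤b′ c≤c′ = +-mono-≤ a≤a′ (+-mono-≤ b≤b′ c≤c′)

module _ {a b d} {A : Set a} {B : Set b} {D : Set d} {f : A → D} {g : B → D} where

  map-disjoint : (∀ x y → f x ≢ g y) → ∀ {xs ys} → Disjoint (map f xs) (map g ys)
  map-disjoint f≢g (v∈fxs , v∈gys) with ∈-map⁻ f v∈fxs | ∈-map⁻ g v∈gys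
  ... | x , _ , refl | y , _ , fx≡gy = f≢g x y fx≡gy

module Map³ {a b c d} {A : Set a} {B : Set b} {C : Set c} {D : Set d}
            (f : A → D) (g : B → D) (h : C → D) (xs : List A) (ys : List B) (zs : List C) where

  list : List D
  list = map f xs ++ map g ys ++ map h zs

  length-list : length list ≡ length xs + (length ys + length zs)
  length-list = ≡.trans (length-++ (map f xs)) (cong₂ _+_ (length-map f xs)
    (≡.trans (length-++ (map g ys)) (cong₂ _+_ (length-map g ys) (length-map h zs))))

  ∈ˡ : ∀ {x} → x ∈ xs → f x ∈ list
  ∈ˡ x∈xs = ∈-++⁺ˡ (∈-map⁺ f x∈xs)

  ∈ᵐ : ∀ {y} → y ∈ ys → g y ∈ list
  ∈ᵐ y∈ys = ∈-++⁺ʳ (map f xs) (∈-++⁺ˡ (∈-map⁺ g y∈ys))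

  ∈ʳ : ∀ {z} → z ∈ zs → h z ∈ list
  ∈ʳ z∈zs = ∈-++⁺ʳ (map f xs) (∈-++⁺ʳ (map g ys) (∈-map⁺ h z∈zs))

  All-list : ∀ {p} {P : D → Set p} →
             (∀ x → P (f x)) → (∀ y → P (g y)) → (∀ z → P (h z)) → All P list
  All-list Pf Pg Ph = Allₚ.++⁺ (Allₚ.map⁺ (All.universal Pf xs))
    (Allₚ.++⁺ (Allₚ.map⁺ (All.universal Pg ys)) (Allₚ.map⁺ (All.universal Ph zs)))

  Unique-list : (∀ {x x′} → f x ≡ f x′ → x ≡ x′) → (∀ {y y′} → g y ≡ g y′ → y ≡ y′) →
                (∀ {z z′} → h z ≡ h z′ → z ≡ z′) →
                (∀ x y → f x ≢ g y) → (∀ x z → f x ≢ h z) → (∀ y z → g y ≢ h z) →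
                Unique xs → Unique ys → Unique zs → Unique list
  Unique-list f-inj g-inj h-inj f≢g f≢h g≢h xs! ys! zs! =
    Uniqueₚ.++⁺ (Uniqueₚ.map⁺ f-inj xs!)
      (Uniqueₚ.++⁺ (Uniqueₚ.map⁺ g-inj ys!) (Uniqueₚ.map⁺ h-inj zs!) (map-disjoint g≢h))
      (λ (v∈f , v∈gh) → [ (λ v∈g → map-disjoint f≢g (v∈f , v∈g))
                          , (λ v∈h → map-disjoint f≢h (v∈f , v∈h)) ]′ (∈-++⁻ (map g ys) v∈gh))

data IsJust {a} {A : Set a} : Maybe A → Set a where
  just : ∀ {x} → IsJust (just x)

module _ {c ℓ} (R : CommutativeRing c ℓ) where
  open CommutativeRing R

  finite⇒≈-decidable : Finite R → Decidable _≈_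
  finite⇒≈-decidable (_ , Fin↔R) =
    via-injection (Inverse⇒Injection (Symmetry.inverse Fin↔R)) Fin._≟_

  IsVertex-resp-≈ : ∀ {x y} → x ≈ y → IsVertex R x → IsVertex R y
  IsVertex-resp-≈ x≈y (x≉0 , z , z≉0 , xz≈0) =
    (λ y≈0 → x≉0 (trans x≈y y≈0)) , z , z≉0 , trans (*-congʳ (sym x≈y)) xz≈0

  Adjacent-resp-≈ : ∀ {x x′ y y′} → x ≈ x′ → y ≈ y′ → Adjacent R x y → Adjacent R x′ y′
  Adjacent-resp-≈ x≈x′ y≈y′ xy≈0 = trans (*-cong (sym x≈x′) (sym y≈y′)) xy≈0

module Coordinate {c ℓ} (F : CommutativeRing c ℓ) (D : IsFiniteIntegralDomain F)
                  {n : ℕ} (C : NonzeroCount F n) where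
  open CommutativeRing F hiding (refl) renaming (_*_ to _·_)
  open IsFiniteIntegralDomain D
  open NonzeroCount C

  fromCode : Maybe (Fin n) → Carrier
  fromCode nothing  = 0#
  fromCode (just i) = enum i

  toCode : Carrier → Maybe (Fin n)
  toCode x with finite⇒≈-decidable F finite x 0#
  ... | yes _   = nothing
  ... | no x≉0 = just (proj₁ (covers x x≉0))

  fromCode-toCode : ∀ x → fromCode (toCode x) ≈ x
  fromCode-toCode x with finite⇒≈-decidable F finite x 0#
  ... | yes x≈0 = sym x≈0
  ... | no x≉0 = sym (proj₂ (covers x x≉0))

  fromCode-injective : ∀ a b → fromCode a ≈ fromCode b → a ≡ b
  fromCode-injective nothing  nothing  _   = refl
  fromCode-injective nothing  (just j) 0≈j = contradiction (sym 0≈j) (nonzero j)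
  fromCode-injective (just i) nothing  i≈0 = contradiction i≈0 (nonzero i)
  fromCode-injective (just i) (just j) i≈j = cong just (injective i j i≈j)

  annihilator : Maybe (Fin n) → Carrier
  annihilator nothing  = 1#
  annihilator (just _) = 0#

  fromCode*annihilator≈0 : ∀ a → fromCode a · annihilator a ≈ 0#
  fromCode*annihilator≈0 nothing  = zeroˡ 1#
  fromCode*annihilator≈0 (just i) = zeroʳ (enum i)

  fromCode*fromCode≈0⊎IsJust : ∀ a b → fromCode a · fromCode b ≈ 0# ⊎ (IsJust a × IsJust b)
  fromCode*fromCode≈0⊎IsJust nothing  b        = inj₁ (zeroˡ (fromCode b))
  fromCode*fromCode≈0⊎IsJust (just i) nothing  = inj₁ (zeroʳ (enum i))
  fromCode*fromCode≈0⊎IsJust (just _) (just _) = inj₂ (just , just)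

  IsJust⇒fromCode*fromCode≉0 : ∀ {a b} → IsJust a → IsJust b → ¬ fromCode a · fromCode b ≈ 0#
  IsJust⇒fromCode*fromCode≉0 (just {i}) (just {j}) =
    [ nonzero i , nonzero j ]′ ∘ noZeroDivisors _ _

  fromCode-just*y≈0⇒y≈0 : ∀ i {y} → fromCode (just i) · y ≈ 0# → y ≈ 0#
  fromCode-just*y≈0⇒y≈0 i iy≈0 =
    [ (λ i≈0 → contradiction i≈0 (nonzero i)) , id ]′ (noZeroDivisors _ _ iy≈0)

module Codes (n₁ n₂ n₃ : ℕ) where

  Code : Set
  Code = Maybe (Fin n₁) × Maybe (Fin n₂) × Maybe (Fin n₃)

  single₁ : Fin n₁ → Code
  single₁ i = just i , nothing , nothing

  single₂ : Fin n₂ → Code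
  single₂ j = nothing , just j , nothing

  single₃ : Fin n₃ → Code
  single₃ k = nothing , nothing , just k

  pair₁₂ : Fin n₁ × Fin n₂ → Code
  pair₁₂ (i , j) = just i , just j , nothing

  pair₁₃ : Fin n₁ × Fin n₃ → Code
  pair₁₃ (i , k) = just i , nothing , just k

  pair₂₃ : Fin n₂ × Fin n₃ → Code
  pair₂₃ (j , k) = nothing , just j , just k

  data Singleton : Code → Set where
    on₁ : ∀ i → Singleton (single₁ i)
    on₂ : ∀ j → Singleton (single₂ j)
    on₃ : ∀ k → Singleton (single₃ k)

  data Pair : Code → Set where
    on₁₂ : ∀ ij → Pair (pair₁₂ ij)
    on₁₃ : ∀ ik → Pair (pair₁₃ ik)
    on₂₃ : ∀ jk → Pair (pair₂₃ jk)

  Proper : Code → Set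
  Proper x = Singleton x ⊎ Pair x

  data Meet : Code → Code → Set where
    meet₁ : ∀ {a b c a′ b′ c′} → IsJust a → IsJust a′ → Meet (a , b , c) (a′ , b′ , c′)
    meet₂ : ∀ {a b c a′ b′ c′} → IsJust b → IsJust b′ → Meet (a , b , c) (a′ , b′ , c′)
    meet₃ : ∀ {a b c a′ b′ c′} → IsJust c → IsJust c′ → Meet (a , b , c) (a′ , b′ , c′)

  Meet-sym : Symmetric Meet
  Meet-sym (meet₁ p q) = meet₁ q p
  Meet-sym (meet₂ p q) = meet₂ q p
  Meet-sym (meet₃ p q) = meet₃ q p

  Proper⇒Meet-refl : ∀ {x} → Proper x → Meet x x
  Proper⇒Meet-refl (inj₁ (on₁ _))  = meet₁ just just
  Proper⇒Meet-refl (inj₁ (on₂ _))  = meet₂ just just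
  Proper⇒Meet-refl (inj₁ (on₃ _))  = meet₃ just just
  Proper⇒Meet-refl (inj₂ (on₁₂ _)) = meet₁ just just
  Proper⇒Meet-refl (inj₂ (on₁₃ _)) = meet₁ just just
  Proper⇒Meet-refl (inj₂ (on₂₃ _)) = meet₂ just just

  Pair⇒Meet : ∀ {x y} → Pair x → Pair y → Meet x y
  Pair⇒Meet (on₁₂ _) (on₁₂ _) = meet₁ just just
  Pair⇒Meet (on₁₂ _) (on₁₃ _) = meet₁ just just
  Pair⇒Meet (on₁₂ _) (on₂₃ _) = meet₂ just just
  Pair⇒Meet (on₁₃ _) (on₁₂ _) = meet₁ just just
  Pair⇒Meet (on₁₃ _) (on₁₃ _) = meet₁ just just
  Pair⇒Meet (on₁₃ _) (on₂₃ _) = meet₃ just just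
  Pair⇒Meet (on₂₃ _) (on₁₂ _) = meet₂ just just
  Pair⇒Meet (on₂₃ _) (on₁₃ _) = meet₃ just just
  Pair⇒Meet (on₂₃ _) (on₂₃ _) = meet₂ just just

  -- Star k lists the codes whose support contains k, Pairs those with a two-point support.
  module S₁ = Map³ pair₁₂ pair₁₃ single₁ (allFin² n₁ n₂) (allFin² n₁ n₃) (allFin n₁)
  module S₂ = Map³ pair₁₂ pair₂₃ single₂ (allFin² n₁ n₂) (allFin² n₂ n₃) (allFin n₂)
  module S₃ = Map³ pair₂₃ pair₁₃ single₃ (allFin² n₂ n₃) (allFin² n₁ n₃) (allFin n₃)
  module P  = Map³ pair₁₂ pair₁₃ pair₂₃ (allFin² n₁ n₂) (allFin² n₁ n₃) (allFin² n₂ n₃)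

  Star₁ Star₂ Star₃ Pairs : List Code
  Star₁ = S₁.list
  Star₂ = S₂.list
  Star₃ = S₃.list
  Pairs = P.list

  Meet-single₁⇒∈-Star₁ : ∀ {i y} → Meet (single₁ i) y → Proper y → y ∈ Star₁
  Meet-single₁⇒∈-Star₁ (meet₁ just just) (inj₁ (on₁ a))       = S₁.∈ʳ (∈-allFin a)
  Meet-single₁⇒∈-Star₁ (meet₁ just just) (inj₂ (on₁₂ (a , b))) = S₁.∈ˡ (∈-allFin² a b)
  Meet-single₁⇒∈-Star₁ (meet₁ just just) (inj₂ (on₁₃ (a , c))) = S₁.∈ᵐ (∈-allFin² a c)
  Meet-single₁⇒∈-Star₁ (meet₂ () _) _
  Meet-single₁⇒∈-Star₁ (meet₃ () _) _

  Meet-single₂⇒∈-Star₂ : ∀ {j y} → Meet (single₂ j) y → Proper y → y ∈ Star₂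
  Meet-single₂⇒∈-Star₂ (meet₂ just just) (inj₁ (on₂ b))       = S₂.∈ʳ (∈-allFin b)
  Meet-single₂⇒∈-Star₂ (meet₂ just just) (inj₂ (on₁₂ (a , b))) = S₂.∈ˡ (∈-allFin² a b)
  Meet-single₂⇒∈-Star₂ (meet₂ just just) (inj₂ (on₂₃ (b , c))) = S₂.∈ᵐ (∈-allFin² b c)
  Meet-single₂⇒∈-Star₂ (meet₁ () _) _
  Meet-single₂⇒∈-Star₂ (meet₃ () _) _

  Meet-single₃⇒∈-Star₃ : ∀ {k y} → Meet (single₃ k) y → Proper y → y ∈ Star₃
  Meet-single₃⇒∈-Star₃ (meet₃ just just) (inj₁ (on₃ c))       = S₃.∈ʳ (∈-allFin c)
  Meet-single₃⇒∈-Star₃ (meet₃ just just) (inj₂ (on₂₃ (b , c))) = S₃.∈ˡ (∈-allFin² b c)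
  Meet-single₃⇒∈-Star₃ (meet₃ just just) (inj₂ (on₁₃ (a , c))) = S₃.∈ᵐ (∈-allFin² a c)
  Meet-single₃⇒∈-Star₃ (meet₁ () _) _
  Meet-single₃⇒∈-Star₃ (meet₂ () _) _

  Pair⇒∈-Pairs : ∀ {y} → Pair y → y ∈ Pairs
  Pair⇒∈-Pairs (on₁₂ (a , b)) = P.∈ˡ (∈-allFin² a b)
  Pair⇒∈-Pairs (on₁₃ (a , c)) = P.∈ᵐ (∈-allFin² a c)
  Pair⇒∈-Pairs (on₂₃ (b , c)) = P.∈ʳ (∈-allFin² b c)

  record IntersectingFamily : Set where
    field
      codes        : List Code
      unique       : Unique codes
      proper       : All Proper codes
      intersecting : AllPairs Meet codes

  module _ (𝓕 : IntersectingFamily) where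
    open IntersectingFamily 𝓕

    ∈⇒Meet : ∀ {x y} → x ∈ codes → y ∈ codes → Meet x y
    ∈⇒Meet x∈ y∈ with AllPairs⇒∈-related Meet-sym intersecting x∈ y∈
    ... | inj₁ refl = Proper⇒Meet-refl (All.lookup proper x∈)
    ... | inj₂ meet = meet

    ⊆-Star⊎⊆-Pairs : codes ⊆ Star₁ ⊎ codes ⊆ Star₂ ⊎ codes ⊆ Star₃ ⊎ codes ⊆ Pairs
    ⊆-Star⊎⊆-Pairs with All-⊎⇒Any⊎All proper
    ... | inj₂ all-pairs = inj₂ (inj₂ (inj₂ (λ y∈ → Pair⇒∈-Pairs (All.lookup all-pairs y∈))))
    ... | inj₁ some-singleton with find some-singleton
    ...   | _ , x∈ , on₁ _ = inj₁ (λ y∈ → Meet-single₁⇒∈-Star₁ (∈⇒Meet x∈ y∈) (All.lookup proper y∈))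
    ...   | _ , x∈ , on₂ _ =
      inj₂ (inj₁ (λ y∈ → Meet-single₂⇒∈-Star₂ (∈⇒Meet x∈ y∈) (All.lookup proper y∈)))
    ...   | _ , x∈ , on₃ _ =
      inj₂ (inj₂ (inj₁ (λ y∈ → Meet-single₃⇒∈-Star₃ (∈⇒Meet x∈ y∈) (All.lookup proper y∈))))

  maxSize : ℕ
  maxSize = n₁ * n₂ + (n₁ * n₃ + (n₁ ⊔ n₂ * n₃))

  length-Star₁ : length Star₁ ≡ n₁ * n₂ + (n₁ * n₃ + n₁)
  length-Star₁ = ≡.trans S₁.length-list
    (cong₂ _+_ (length-allFin² n₁ n₂) (cong₂ _+_ (length-allFin² n₁ n₃) (length-allFin n₁)))

  length-Star₂ : length Star₂ ≡ n₁ * n₂ + (n₂ * n₃ + n₂)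
  length-Star₂ = ≡.trans S₂.length-list
    (cong₂ _+_ (length-allFin² n₁ n₂) (cong₂ _+_ (length-allFin² n₂ n₃) (length-allFin n₂)))

  length-Star₃ : length Star₃ ≡ n₂ * n₃ + (n₁ * n₃ + n₃)
  length-Star₃ = ≡.trans S₃.length-list
    (cong₂ _+_ (length-allFin² n₂ n₃) (cong₂ _+_ (length-allFin² n₁ n₃) (length-allFin n₃)))

  length-Pairs : length Pairs ≡ n₁ * n₂ + (n₁ * n₃ + n₂ * n₃)
  length-Pairs = ≡.trans P.length-list
    (cong₂ _+_ (length-allFin² n₁ n₂) (cong₂ _+_ (length-allFin² n₁ n₃) (length-allFin² n₂ n₃)))

  length-Star₁≤maxSize : length Star₁ ≤ maxSize
  length-Star₁≤maxSize = ≤-trans (≤-reflexive length-Star₁)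
    (+-mono³-≤ (≤-refl {n₁ * n₂}) (≤-refl {n₁ * n₃}) (m≤m⊔n n₁ (n₂ * n₃)))

  length-Star₂≤maxSize : n₂ ≤ n₁ → length Star₂ ≤ maxSize
  length-Star₂≤maxSize n₂≤n₁ = ≤-trans (≤-reflexive length-Star₂)
    (+-mono³-≤ (≤-refl {n₁ * n₂}) (*-mono-≤ n₂≤n₁ (≤-refl {n₃}))
               (≤-trans n₂≤n₁ (m≤m⊔n n₁ (n₂ * n₃))))

  length-Star₃≤maxSize : n₂ ≤ n₁ → n₃ ≤ n₂ → length Star₃ ≤ maxSize
  length-Star₃≤maxSize n₂≤n₁ n₃≤n₂ = ≤-trans (≤-reflexive length-Star₃)
    (+-mono³-≤ (*-mono-≤ n₂≤n₁ n₃≤n₂) (≤-refl {n₁ * n₃})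
               (≤-trans (≤-trans n₃≤n₂ n₂≤n₁) (m≤m⊔n n₁ (n₂ * n₃))))

  length-Pairs≤maxSize : length Pairs ≤ maxSize
  length-Pairs≤maxSize = ≤-trans (≤-reflexive length-Pairs)
    (+-mono³-≤ (≤-refl {n₁ * n₂}) (≤-refl {n₁ * n₃}) (m≤n⊔m n₁ (n₂ * n₃)))

  size≤maxSize : n₂ ≤ n₁ → n₃ ≤ n₂ → (𝓕 : IntersectingFamily) →
                 length (IntersectingFamily.codes 𝓕) ≤ maxSize
  size≤maxSize n₂≤n₁ n₃≤n₂ 𝓕 =
    [ bound length-Star₁≤maxSize
    , [ bound (length-Star₂≤maxSize n₂≤n₁)
      , [ bound (length-Star₃≤maxSize n₂≤n₁ n₃≤n₂) , bound length-Pairs≤maxSize ]′ ]′ ]′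
    (⊆-Star⊎⊆-Pairs 𝓕)
    where
    open IntersectingFamily 𝓕
    bound : ∀ {S} → length S ≤ maxSize → codes ⊆ S → length codes ≤ maxSize
    bound |S|≤max codes⊆S = ≤-trans (Unique-⊆⇒length-≤ unique codes⊆S) |S|≤max

  Star₁-family : IntersectingFamily
  Star₁-family = record
    { codes        = Star₁
    ; unique       = S₁.Unique-list (λ { refl → refl }) (λ { refl → refl }) (λ { refl → refl })
                       (λ _ _ ()) (λ _ _ ()) (λ _ _ ())
                       (Unique-allFin² n₁ n₂) (Unique-allFin² n₁ n₃) (Uniqueₚ.allFin⁺ n₁)
    ; proper       = S₁.All-list (inj₂ ∘ on₁₂) (inj₂ ∘ on₁₃) (inj₁ ∘ on₁)
    ; intersecting = All⇒AllPairs {P = IsJust ∘ proj₁} meet₁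
                       (S₁.All-list (λ _ → just) (λ _ → just) (λ _ → just))
    }

  Pairs-family : IntersectingFamily
  Pairs-family = record
    { codes        = Pairs
    ; unique       = P.Unique-list (λ { refl → refl }) (λ { refl → refl }) (λ { refl → refl })
                       (λ _ _ ()) (λ _ _ ()) (λ _ _ ())
                       (Unique-allFin² n₁ n₂) (Unique-allFin² n₁ n₃) (Unique-allFin² n₂ n₃)
    ; proper       = P.All-list (inj₂ ∘ on₁₂) (inj₂ ∘ on₁₃) (inj₂ ∘ on₂₃)
    ; intersecting = All⇒AllPairs Pair⇒Meet (P.All-list on₁₂ on₁₃ on₂₃)
    }

  maxSize-attained : Σ IntersectingFamily λ 𝓕 → length (IntersectingFamily.codes 𝓕) ≡ maxSize
  maxSize-attained with ≤-total (n₂ * n₃) n₁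
  ... | inj₁ n₂n₃≤n₁ = Star₁-family , ≡.trans length-Star₁ (cong (n₁ * n₂ +_) (cong (n₁ * n₃ +_)
                                        (≡.sym (m≥n⇒m⊔n≡m n₂n₃≤n₁))))
  ... | inj₂ n₁≤n₂n₃ = Pairs-family , ≡.trans length-Pairs (cong (n₁ * n₂ +_) (cong (n₁ * n₃ +_)
                                        (≡.sym (m≤n⇒m⊔n≡n n₁≤n₂n₃))))

module Product {c ℓ} (F₁ F₂ F₃ : CommutativeRing c ℓ) {n₁ n₂ n₃ : ℕ}
  (D₁ : IsFiniteIntegralDomain F₁) (D₂ : IsFiniteIntegralDomain F₂) (D₃ : IsFiniteIntegralDomain F₃)
  (C₁ : NonzeroCount F₁ n₁) (C₂ : NonzeroCount F₂ n₂) (C₃ : NonzeroCount F₃ n₃) where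

  module K₁ = Coordinate F₁ D₁ C₁
  module K₂ = Coordinate F₂ D₂ C₂
  module K₃ = Coordinate F₃ D₃ C₃
  open IsFiniteIntegralDomain D₁ using () renaming (nontrivial to 1≉0₁)
  open IsFiniteIntegralDomain D₂ using () renaming (nontrivial to 1≉0₂)
  open IsFiniteIntegralDomain D₃ using () renaming (nontrivial to 1≉0₃)
  open Codes n₁ n₂ n₃

  R : CommutativeRing c ℓ
  R = triple F₁ F₂ F₃

  open CommutativeRing R using (Carrier; _≈_; 0#; zeroˡ; *-congʳ)
  module ≈ = CommutativeRing R using (refl; sym; trans; reflexive)

  decode : Code → Carrier
  decode (a , b , c) = K₁.fromCode a , K₂.fromCode b , K₃.fromCode c

  encode : Carrier → Code
  encode (x , y , z) = K₁.toCode x , K₂.toCode y , K₃.toCode z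

  decode-encode : ∀ x → decode (encode x) ≈ x
  decode-encode (x , y , z) = K₁.fromCode-toCode x , K₂.fromCode-toCode y , K₃.fromCode-toCode z

  decode-injective : ∀ {x y} → decode x ≈ decode y → x ≡ y
  decode-injective {a , b , c} {a′ , b′ , c′} (a≈a′ , b≈b′ , c≈c′) =
    cong₂ _,_ (K₁.fromCode-injective a a′ a≈a′)
              (cong₂ _,_ (K₂.fromCode-injective b b′ b≈b′) (K₃.fromCode-injective c c′ c≈c′))

  encode-injective : ∀ {x y} → encode x ≡ encode y → x ≈ y
  encode-injective {x} {y} ex≡ey =
    ≈.trans (≈.sym (decode-encode x)) (≈.trans (≈.reflexive (cong decode ex≡ey)) (decode-encode y))

  Meet⇒¬Adjacent : ∀ {x y} → Meet x y → ¬ Adjacent R (decode x) (decode y)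
  Meet⇒¬Adjacent (meet₁ p q) (≈0 , _)     = K₁.IsJust⇒fromCode*fromCode≉0 p q ≈0
  Meet⇒¬Adjacent (meet₂ p q) (_ , ≈0 , _) = K₂.IsJust⇒fromCode*fromCode≉0 p q ≈0
  Meet⇒¬Adjacent (meet₃ p q) (_ , _ , ≈0) = K₃.IsJust⇒fromCode*fromCode≉0 p q ≈0

  Meet⊎Adjacent : ∀ x y → Meet x y ⊎ Adjacent R (decode x) (decode y)
  Meet⊎Adjacent (a , b , c) (a′ , b′ , c′)
    with K₁.fromCode*fromCode≈0⊎IsJust a a′ | K₂.fromCode*fromCode≈0⊎IsJust b b′
       | K₃.fromCode*fromCode≈0⊎IsJust c c′
  ... | inj₂ (p , q) | _            | _            = inj₁ (meet₁ p q)
  ... | inj₁ _       | inj₂ (p , q) | _            = inj₁ (meet₂ p q)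
  ... | inj₁ _       | inj₁ _       | inj₂ (p , q) = inj₁ (meet₃ p q)
  ... | inj₁ ≈0₁     | inj₁ ≈0₂     | inj₁ ≈0₃     = inj₂ (≈0₁ , ≈0₂ , ≈0₃)

  ¬Adjacent⇒Meet-encode : ∀ {x y} → ¬ Adjacent R x y → Meet (encode x) (encode y)
  ¬Adjacent⇒Meet-encode {x} {y} ¬xy≈0 =
    [ id , (λ adj → contradiction (Adjacent-resp-≈ R (decode-encode x) (decode-encode y) adj) ¬xy≈0)
    ]′ (Meet⊎Adjacent (encode x) (encode y))

  annihilator : Code → Carrier
  annihilator (a , b , c) = K₁.annihilator a , K₂.annihilator b , K₃.annihilator c

  annihilator-nonzero : ∀ {x} → Proper x → ¬ annihilator x ≈ 0#
  annihilator-nonzero (inj₁ (on₁ _))  = 1≉0₂ ∘ proj₁ ∘ proj₂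
  annihilator-nonzero (inj₁ (on₂ _))  = 1≉0₁ ∘ proj₁
  annihilator-nonzero (inj₁ (on₃ _))  = 1≉0₁ ∘ proj₁
  annihilator-nonzero (inj₂ (on₁₂ _)) = 1≉0₃ ∘ proj₂ ∘ proj₂
  annihilator-nonzero (inj₂ (on₁₃ _)) = 1≉0₂ ∘ proj₁ ∘ proj₂
  annihilator-nonzero (inj₂ (on₂₃ _)) = 1≉0₁ ∘ proj₁

  -- decode x ≉ 0 because its square is nonzero.
  Proper⇒IsVertex : ∀ {x} → Proper x → IsVertex R (decode x)
  Proper⇒IsVertex {a , b , c} proper =
      (λ x≈0 → Meet⇒¬Adjacent (Proper⇒Meet-refl proper) (≈.trans (*-congʳ x≈0) (zeroˡ _)))
    , annihilator (a , b , c) , annihilator-nonzero proper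
    , (K₁.fromCode*annihilator≈0 a , K₂.fromCode*annihilator≈0 b , K₃.fromCode*annihilator≈0 c)

  IsVertex⇒Proper : ∀ x → IsVertex R (decode x) → Proper x
  IsVertex⇒Proper (nothing , nothing , nothing) (x≉0 , _) = contradiction ≈.refl x≉0
  IsVertex⇒Proper (just i  , nothing , nothing) _ = inj₁ (on₁ i)
  IsVertex⇒Proper (nothing , just j  , nothing) _ = inj₁ (on₂ j)
  IsVertex⇒Proper (nothing , nothing , just k ) _ = inj₁ (on₃ k)
  IsVertex⇒Proper (just i  , just j  , nothing) _ = inj₂ (on₁₂ (i , j))
  IsVertex⇒Proper (just i  , nothing , just k ) _ = inj₂ (on₁₃ (i , k))
  IsVertex⇒Proper (nothing , just j  , just k ) _ = inj₂ (on₂₃ (j , k))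
  IsVertex⇒Proper (just i  , just j  , just k ) (_ , _ , y≉0 , (iy₁≈0 , jy₂≈0 , ky₃≈0)) =
    contradiction (K₁.fromCode-just*y≈0⇒y≈0 i iy₁≈0 , K₂.fromCode-just*y≈0⇒y≈0 j jy₂≈0 ,
                   K₃.fromCode-just*y≈0⇒y≈0 k ky₃≈0) y≉0

  toIndependentSet : IntersectingFamily → IndependentSet R
  toIndependentSet 𝓕 = record
    { elems       = map decode codes
    ; distinct    = AllPairsₚ.map⁺ (AllPairs.map (λ x≢y → x≢y ∘ decode-injective) unique)
    ; vertices    = Allₚ.map⁺ (All.map Proper⇒IsVertex proper)
    ; nonAdjacent = AllPairsₚ.map⁺ (AllPairs.map Meet⇒¬Adjacent intersecting)
    }
    where open IntersectingFamily 𝓕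

  fromIndependentSet : IndependentSet R → IntersectingFamily
  fromIndependentSet I = record
    { codes        = map encode elems
    ; unique       = AllPairsₚ.map⁺ (AllPairs.map (λ x≉y → x≉y ∘ encode-injective) distinct)
    ; proper       = Allₚ.map⁺ (All.map (λ {x} → IsVertex⇒Proper (encode x) ∘
                                        IsVertex-resp-≈ R (≈.sym (decode-encode x))) vertices)
    ; intersecting = AllPairsₚ.map⁺ (AllPairs.map ¬Adjacent⇒Meet-encode nonAdjacent)
    }
    where open IndependentSet I

  length-toIndependentSet : ∀ 𝓕 →
    length (IndependentSet.elems (toIndependentSet 𝓕)) ≡ length (IntersectingFamily.codes 𝓕)
  length-toIndependentSet 𝓕 = length-map decode (IntersectingFamily.codes 𝓕)

  length-fromIndependentSet : ∀ I →
    length (IntersectingFamily.codes (fromIndependentSet I)) ≡ length (IndependentSet.elems I)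
  length-fromIndependentSet I = length-map encode (IndependentSet.elems I)

  independenceNumber-maxSize : n₂ ≤ n₁ → n₃ ≤ n₂ → IndependenceNumber R maxSize
  independenceNumber-maxSize n₂≤n₁ n₃≤n₂ with maxSize-attained
  ... | 𝓕 , |𝓕|≡max =
      (toIndependentSet 𝓕 , ≡.trans (length-toIndependentSet 𝓕) |𝓕|≡max)
    , λ I → ≤-trans (≤-reflexive (≡.sym (length-fromIndependentSet I)))
                    (size≤maxSize n₂≤n₁ n₃≤n₂ (fromIndependentSet I))

theorem9 : ∀ {c ℓ : Level} (F₁ F₂ F₃ : CommutativeRing c ℓ) (n₁ n₂ n₃ : ℕ) →
    IsFiniteIntegralDomain F₁ → IsFiniteIntegralDomain F₂ → IsFiniteIntegralDomain F₃ →
    NonzeroCount F₁ n₁ → NonzeroCount F₂ n₂ → NonzeroCount F₃ n₃ →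
    n₁ ≥ n₂ → n₂ ≥ n₃ →
    IndependenceNumber (triple F₁ F₂ F₃) (n₁ * n₂ + n₁ * n₃ + (n₁ ⊔ (n₂ * n₃)))
theorem9 F₁ F₂ F₃ n₁ n₂ n₃ D₁ D₂ D₃ C₁ C₂ C₃ n₂≤n₁ n₃≤n₂ =
  ≡.subst (IndependenceNumber (triple F₁ F₂ F₃))
          (≡.sym (+-assoc (n₁ * n₂) (n₁ * n₃) (n₁ ⊔ (n₂ * n₃))))
    (Product.independenceNumber-maxSize F₁ F₂ F₃ D₁ D₂ D₃ C₁ C₂ C₃ n₂≤n₁ n₃≤n₂)
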